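{- Let $n \ge 3$ and let $K_n$ be the complete graph on $[n]$ with every edge of weight $1$ (so $E(K_n)$ consists of all $\binom{n}{2}$ pairs). Then the max cut dimension of $K_n$ equals $\binom{n}{2}$ if $n$ is odd and $\binom{n-1}{2}$ if $n$ is even.
   Context: For a weighted undirected graph $G$ on $[n]$ with cut function $F(S) = \sum_{i \in S, j \notin S} w_{i,j}$, let $E(G)$ be the set of vertex pairs with positive weight. For $S \subseteq [n]$, the query vector $v_S \in \mathbb{R}^{E(G)}$ has $(v_S)_{i,j} = 1$ if exactly one of $i, j$ lies in $S$ and $0$ otherwise. The max cut space of $G$ is the linear span of $\{v_U : U \in \arg\max_{S \subseteq [n]} F(S)\}$, and the max cut dimension of $G$ is the dimension of this span.
   Formalization: The max cut space and its dimension are taken over ℚ rather than ℝ. -}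

module Defs where

open import Data.Nat as ℕ using (ℕ; zero; suc)
open import Data.Bool using (Bool; true; false; if_then_else_; _∧_; not; _xor_)
open import Data.Fin using (Fin)
import Data.Fin as F
open import Data.Fin.Subset using (Subset)
open import Data.Vec using (lookup)
open import Data.Product using (Σ; _×_; _,_; ∃; proj₁; proj₂)
open import Data.List using (List; []; _∷_)
open import Data.List.Relation.Unary.All using (All)
open import Data.Rational using (ℚ; 0ℚ; 1ℚ; _+_; _*_)
open import Relation.Binary.PropositionalEquality using (_≡_)

sumℕ : ∀ {n} → (Fin n → ℕ) → ℕ
sumℕ {zero}  f = 0
sumℕ {suc n} f = f F.zero ℕ.+ sumℕ (λ i → f (F.suc i))

sumℚ : ∀ {n} → (Fin n → ℚ) → ℚ
sumℚ {zero}  f = 0ℚ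
sumℚ {suc n} f = f F.zero + sumℚ (λ i → f (F.suc i))

-- A weighted undirected graph on [n] = Fin n: symmetric nonnegative weights
-- (weights are natural numbers here; this suffices for K_n).
Weights : ℕ → Set
Weights n = Fin n → Fin n → ℕ

cut : ∀ {n} → Weights n → Subset n → ℕ
cut w S = sumℕ λ i → sumℕ λ j →
  if lookup S i ∧ not (lookup S j) then w i j else 0

IsMaxCut : ∀ {n} → Weights n → Subset n → Set
IsMaxCut w S = ∀ T → cut w T ℕ.≤ cut w S

Edge : ∀ {n} → Weights n → Set
Edge {n} w = Σ (Fin n × Fin n) λ p → (proj₁ p F.< proj₂ p) × (0 ℕ.< w (proj₁ p) (proj₂ p))

EVec : ∀ {n} → Weights n → Set
EVec w = Edge w → ℚ

queryVec : ∀ {n} (w : Weights n) → Subset n → EVec w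
queryVec w S ((i , j) , _) = if lookup S i xor lookup S j then 1ℚ else 0ℚ

combo : ∀ {n} (w : Weights n) → List (ℚ × Subset n) → EVec w
combo w []             e = 0ℚ
combo w ((c , U) ∷ L)  e = c * queryVec w U e + combo w L e

InMaxCutSpace : ∀ {n} (w : Weights n) → EVec w → Set
InMaxCutSpace {n} w x =
  ∃ λ (L : List (ℚ × Subset n)) →
    All (λ p → IsMaxCut w (proj₂ p)) L × (∀ e → x e ≡ combo w L e)

LinIndep : ∀ {n} (w : Weights n) {d} → (Fin d → EVec w) → Set
LinIndep w {d} b =
  (c : Fin d → ℚ) → (∀ e → sumℚ (λ k → c k * b k e) ≡ 0ℚ) → ∀ k → c k ≡ 0ℚ

InSpan : ∀ {n} (w : Weights n) {d} → (Fin d → EVec w) → EVec w → Set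
InSpan w {d} b x = ∃ λ (c : Fin d → ℚ) → ∀ e → x e ≡ sumℚ (λ k → c k * b k e)

MaxCutDim : ∀ {n} → Weights n → ℕ → Set
MaxCutDim w d =
  ∃ λ (b : Fin d → EVec w) →
    (∀ k → InMaxCutSpace w (b k)) ×
    LinIndep w b ×
    (∀ U → IsMaxCut w U → InSpan w b (queryVec w U))

-- The complete graph K_n with all weights 1 (w i i is irrelevant: never counted
-- in E, and contributes 0 to every cut).
completeGraph : (n : ℕ) → Weights n
completeGraph n i j = 1

module Submission where

-- For odd n = 2m+1 the maximum cuts of K_n are the sets of size m and m+1. Given distinct
-- j, l, p and a set S₀ of size m-1 avoiding them,
-- v(S₀∪{l}) - v(S₀∪{l,j}) - v(S₀∪{p}) + v(S₀∪{p,j}) = 2 (e_jl - e_jp), so every difference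
-- e_k - e_ij of edge vectors is spanned by maximum cuts; subtracting Σ_k v_S(k) (e_k - e_ij)
-- from v_S leaves |S| |Sᶜ| e_ij, so every edge vector is spanned and the max cut space is ℚ^E.
-- For even n = 2h the maximum cuts are the h-sets. Adding vertex 0 to the (h-1)-sets lifts
-- these combinations from K_{n-1} to C(n-1,2) combinations of h-set cut vectors that agree with
-- the edge vectors of K_{n-1} on its edges, hence are independent. They span: a combination of
-- h-set cut vectors has the same degree D at every vertex, so if it vanishes on the edges of
-- K_{n-1}, its degree at vertex 0 is (n-1) D = D, whence D = 0 and it vanishes everywhere.

open import Defs
open import Algebra.Bundles using (CommutativeRing; Semiring)
import Algebra.Properties.Semiring.Mult as SemiringMult
import Algebra.Properties.Semiring.Sum as SemiringSum
open import Data.Bool using (Bool; true; false; if_then_else_; _∧_; _∨_; not; _xor_)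
import Data.Bool.Properties as BoolP
open import Data.Empty using (⊥-elim)
open import Data.Fin as F using (Fin; _↑ˡ_; _↑ʳ_; splitAt)
import Data.Fin.Properties as FinP
open import Data.Fin.Subset using (Subset; ∣_∣; ∁; ⁅_⁆; _∪_; _⊆_; _∈_; ⊤)
import Data.Fin.Subset.Properties as SubsetP
open import Data.List as List using (List; []; _∷_; _++_)
open import Data.List.Relation.Unary.All as All using (All; []; _∷_)
import Data.List.Relation.Unary.All.Properties as AllP
open import Data.Nat as ℕ using (ℕ; zero; suc; _≤_; z≤n; s≤s; _∸_; _%_)
open import Data.Nat.Combinatorics using (_C_; nC1≡n; nCk+nC[k+1]≡[n+1]C[k+1])
import Data.Nat.Properties as ℕP
import Data.Nat.Solver as ℕSolver
open import Data.Product as Product using (∃-syntax; _×_; _,_; proj₁; proj₂; uncurry)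
open import Data.Rational as Q using (ℚ; 0ℚ; 1ℚ)
import Data.Rational.Properties as ℚP
open import Algebra.Properties.Group ℚP.+-0-group using (x∙y⁻¹≈ε⇒x≈y)
import Data.Rational.Solver as ℚSolver
open import Data.Sum using (_⊎_; inj₁; inj₂; [_,_]′)
open import Data.Vec using ([]; _∷_; lookup)
import Data.Vec.Properties as VecP
open import Function using (_∘_)
open import Level using (0ℓ)
open import Relation.Binary.Definitions using (tri<; tri≈; tri>)
open import Relation.Binary.PropositionalEquality
open import Relation.Nullary using (yes; no; does; contradiction)
open import Relation.Nullary.Decidable using (dec-true; dec-false; toWitness)

ℚ-semiring : Semiring 0ℓ 0ℓ
ℚ-semiring = CommutativeRing.semiring ℚP.+-*-commutativeRing

open SemiringMult ℚ-semiring using (×-homo-+; ×-assoc-*) renaming (_×_ to _·_)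

module _ where
  open Q using (_+_; _*_; _-_)
  open ℚSolver.+-*-Solver
  open SemiringSum ℚ-semiring
    using (sum; sum-cong-≗; sum-replicate; sum-replicate-zero; ∑-distrib-+; *-distribˡ-sum)

  sumℚ≡sum : ∀ {d} (f : Fin d → ℚ) → sumℚ f ≡ sum f
  sumℚ≡sum {zero}  f = refl
  sumℚ≡sum {suc d} f = cong (f F.zero +_) (sumℚ≡sum (f ∘ F.suc))

  sumℚ-cong : ∀ {d} {f g : Fin d → ℚ} → (∀ k → f k ≡ g k) → sumℚ f ≡ sumℚ g
  sumℚ-cong {f = f} {g} f≗g rewrite sumℚ≡sum f | sumℚ≡sum g = sum-cong-≗ f≗g

  sumℚ-zero : ∀ d → sumℚ {d} (λ _ → 0ℚ) ≡ 0ℚ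
  sumℚ-zero d rewrite sumℚ≡sum {d} (λ _ → 0ℚ) = sum-replicate-zero d

  sumℚ-const : ∀ d x → sumℚ {d} (λ _ → x) ≡ d · x
  sumℚ-const d x rewrite sumℚ≡sum {d} (λ _ → x) = sum-replicate d

  sumℚ-+ : ∀ {d} (f g : Fin d → ℚ) → sumℚ (λ k → f k + g k) ≡ sumℚ f + sumℚ g
  sumℚ-+ f g rewrite sumℚ≡sum f | sumℚ≡sum g | sumℚ≡sum (λ k → f k + g k) = ∑-distrib-+ f g

  sumℚ-*ˡ : ∀ {d} r (f : Fin d → ℚ) → sumℚ (λ k → r * f k) ≡ r * sumℚ f
  sumℚ-*ˡ r f rewrite sumℚ≡sum f | sumℚ≡sum (λ k → r * f k) = sym (*-distribˡ-sum r f)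

  sumℚ-↑ : ∀ a {b} (f : Fin (a ℕ.+ b) → ℚ) →
    sumℚ f ≡ sumℚ (λ i → f (i ↑ˡ b)) + sumℚ (λ j → f (a ↑ʳ j))
  sumℚ-↑ zero    f = sym (ℚP.+-identityˡ _)
  sumℚ-↑ (suc a) f = trans (cong (f F.zero +_) (sumℚ-↑ a (f ∘ F.suc))) (sym (ℚP.+-assoc (f F.zero) _ _))

  𝟙 : Bool → ℚ
  𝟙 b = if b then 1ℚ else 0ℚ

  sumℚ-𝟙-≟ : ∀ {d} (f : Fin d → ℚ) k₀ → sumℚ (λ k → f k * 𝟙 (does (k F.≟ k₀))) ≡ f k₀
  sumℚ-𝟙-≟ {suc d} f F.zero = begin
    f F.zero * 1ℚ + sumℚ (λ k → f (F.suc k) * 0ℚ)  ≡⟨ cong₂ _+_ (ℚP.*-identityʳ (f F.zero)) (sumℚ-cong {d} (ℚP.*-zeroʳ ∘ f ∘ F.suc)) ⟩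
    f F.zero + sumℚ {d} (λ _ → 0ℚ)                 ≡⟨ cong (f F.zero +_) (sumℚ-zero d) ⟩
    f F.zero + 0ℚ                                 ≡⟨ ℚP.+-identityʳ _ ⟩
    f F.zero                                      ∎
    where open ≡-Reasoning
  sumℚ-𝟙-≟ {suc d} f (F.suc k₀) =
    trans (cong₂ _+_ (ℚP.*-zeroʳ (f F.zero)) (sumℚ-𝟙-≟ (f ∘ F.suc) k₀)) (ℚP.+-identityˡ _)

  private
    ·1-nonneg : ∀ k → 0ℚ Q.≤ k · 1ℚ
    ·1-nonneg zero    = ℚP.≤-refl
    ·1-nonneg (suc k) = ℚP.+-mono-≤ (toWitness {a? = 0ℚ Q.≤? 1ℚ} _) (·1-nonneg k)

  suc·1≢0 : ∀ k → suc k · 1ℚ ≢ 0ℚ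
  suc·1≢0 k eq = ℚP.<-irrefl (sym eq) (ℚP.+-mono-<-≤ (toWitness {a? = 0ℚ Q.<? 1ℚ} _) (·1-nonneg k))

  product·1≢0 : ∀ {a b} → 0 ℕ.< a → 0 ℕ.< b → (a ℕ.* b) · 1ℚ ≢ 0ℚ
  product·1≢0 {suc a} {suc b} _ _ = suc·1≢0 (b ℕ.+ a ℕ.* suc b)

  *-zero-cancel : ∀ {x y} → x ≢ 0ℚ → x * y ≡ 0ℚ → y ≡ 0ℚ
  *-zero-cancel {x} {y} x≢0 xy≡0 = begin
    y                  ≡⟨ ℚP.*-identityˡ y ⟨
    1ℚ * y             ≡⟨ cong (_* y) (ℚP.*-inverseˡ x) ⟨
    Q.1/ x * x * y     ≡⟨ ℚP.*-assoc (Q.1/ x) x y ⟩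
    Q.1/ x * (x * y)   ≡⟨ cong (Q.1/ x *_) xy≡0 ⟩
    Q.1/ x * 0ℚ        ≡⟨ ℚP.*-zeroʳ (Q.1/ x) ⟩
    0ℚ                 ∎
    where
    open ≡-Reasoning
    instance
      x-nonZero : Q.NonZero x
      x-nonZero = Q.≢-nonZero x≢0

  ·-fixed⇒0 : ∀ N → 1 ℕ.< N → ∀ D → N · D ≡ D → D ≡ 0ℚ
  ·-fixed⇒0 (suc (suc k)) (s≤s (s≤s z≤n)) D fixed = *-zero-cancel (suc·1≢0 k) (begin
    suc k · 1ℚ * D           ≡⟨ trans (×-assoc-* (suc k) 1ℚ D) (cong (suc k ·_) (ℚP.*-identityˡ D)) ⟩
    suc k · D                ≡⟨ solve 2 (λ d y → y := d :+ y :- d) refl D (suc k · D) ⟩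
    D + suc k · D - D        ≡⟨ cong (_- D) fixed ⟩
    D - D                    ≡⟨ ℚP.+-inverseʳ D ⟩
    0ℚ                       ∎)
    where open ≡-Reasoning

module _ where
  open Q using (_+_; _*_; _-_; -_)
  open ℚSolver.+-*-Solver

  -- Only the values at a < b, i.e. on the edges of K_n, are ever compared.
  PairFn : ℕ → Set
  PairFn n = Fin n → Fin n → ℚ

  infix 4 _≐_
  _≐_ : ∀ {n} → PairFn n → PairFn n → Set
  x ≐ y = ∀ a b → a F.< b → x a b ≡ y a b

  pairVec : ∀ {n} → Fin n × Fin n → PairFn n
  pairVec (x , y) a b = 𝟙 ((does (a F.≟ x) ∧ does (b F.≟ y)) ∨ (does (a F.≟ y) ∧ does (b F.≟ x)))

  cutVec : ∀ {n} → Subset n → PairFn n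
  cutVec S a b = 𝟙 (lookup S a xor lookup S b)

  pairVec-sym : ∀ {n} (x y : Fin n) a b → pairVec (x , y) a b ≡ pairVec (y , x) a b
  pairVec-sym x y a b = cong 𝟙 (BoolP.∨-comm (does (a F.≟ x) ∧ does (b F.≟ y)) _)

  combination : ∀ {n} → List (ℚ × Subset n) → PairFn n
  combination []            a b = 0ℚ
  combination ((c , U) ∷ L) a b = c * cutVec U a b + combination L a b

  cutVec-sym : ∀ {n} (S : Subset n) a b → cutVec S a b ≡ cutVec S b a
  cutVec-sym S a b = cong 𝟙 (BoolP.xor-comm (lookup S a) (lookup S b))

  cutVec-diag : ∀ {n} (S : Subset n) a → cutVec S a a ≡ 0ℚ
  cutVec-diag S a = cong 𝟙 (BoolP.xor-same (lookup S a))

  combination-sym : ∀ {n} (L : List (ℚ × Subset n)) a b → combination L a b ≡ combination L b a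
  combination-sym []            a b = refl
  combination-sym ((c , U) ∷ L) a b = cong₂ (λ x y → c * x + y) (cutVec-sym U a b) (combination-sym L a b)

  combination-diag : ∀ {n} (L : List (ℚ × Subset n)) a → combination L a a ≡ 0ℚ
  combination-diag []            a = refl
  combination-diag ((c , U) ∷ L) a = trans (cong₂ (λ x y → c * x + y) (cutVec-diag U a) (combination-diag L a))
                                           (trans (ℚP.+-identityʳ _) (ℚP.*-zeroʳ c))

  combo≡combination : ∀ {n} (w : Weights n) L (e : Edge w) →
    combo w L e ≡ combination L (proj₁ (proj₁ e)) (proj₂ (proj₁ e))
  combo≡combination w []            e = refl
  combo≡combination w ((c , U) ∷ L) e = cong (c * cutVec U _ _ +_) (combo≡combination w L e)

  scale : ∀ {n} → ℚ → List (ℚ × Subset n) → List (ℚ × Subset n)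
  scale r = List.map (Product.map₁ (r *_))

  module _ {n} (a b : Fin n) where

    combination-++ : ∀ L L′ → combination (L ++ L′) a b ≡ combination L a b + combination L′ a b
    combination-++ []            L′ = sym (ℚP.+-identityˡ _)
    combination-++ ((c , U) ∷ L) L′ =
      trans (cong (c * cutVec U a b +_) (combination-++ L L′)) (sym (ℚP.+-assoc (c * cutVec U a b) _ _))

    combination-scale : ∀ r L → combination (scale r L) a b ≡ r * combination L a b
    combination-scale r []            = sym (ℚP.*-zeroʳ r)
    combination-scale r ((c , U) ∷ L) =
      trans (cong (r * c * cutVec U a b +_) (combination-scale r L))
            (solve 4 (λ r c v z → r :* c :* v :+ r :* z := r :* (c :* v :+ z)) refl r c (cutVec U a b) _)

    combination-concat : ∀ {d} (Ls : Fin d → List (ℚ × Subset n)) →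
      combination (List.concat (List.tabulate Ls)) a b ≡ sumℚ (λ k → combination (Ls k) a b)
    combination-concat {zero}  Ls = refl
    combination-concat {suc d} Ls =
      trans (combination-++ (Ls F.zero) _) (cong (combination (Ls F.zero) a b +_) (combination-concat (Ls ∘ F.suc)))

  Spanned : ∀ {n} → (Subset n → Set) → PairFn n → Set
  Spanned G x = ∃[ L ] All (G ∘ proj₂) L × x ≐ combination L

  module _ {n} {G : Subset n → Set} where

    Spanned-≐ : ∀ {x y} → Spanned G x → y ≐ x → Spanned G y
    Spanned-≐ (L , G-L , x≐L) y≐x = L , G-L , λ a b a<b → trans (y≐x a b a<b) (x≐L a b a<b)

    Spanned-0 : Spanned G (λ _ _ → 0ℚ)
    Spanned-0 = [] , [] , λ _ _ _ → refl

    Spanned-cutVec : ∀ {S} → G S → Spanned G (cutVec S)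
    Spanned-cutVec {S} G-S = (1ℚ , S) ∷ [] , G-S ∷ [] ,
      λ a b _ → solve 1 (λ v → v := con 1ℚ :* v :+ con 0ℚ) refl (cutVec S a b)

    Spanned-* : ∀ r {x} → Spanned G x → Spanned G (λ a b → r * x a b)
    Spanned-* r (L , G-L , x≐L) = scale r L , AllP.map⁺ G-L ,
      λ a b a<b → trans (cong (r *_) (x≐L a b a<b)) (sym (combination-scale a b r L))

    Spanned-+ : ∀ {x y} → Spanned G x → Spanned G y → Spanned G (λ a b → x a b + y a b)
    Spanned-+ (L , G-L , x≐L) (L′ , G-L′ , y≐L′) = L ++ L′ , AllP.++⁺ G-L G-L′ ,
      λ a b a<b → trans (cong₂ _+_ (x≐L a b a<b) (y≐L′ a b a<b)) (sym (combination-++ a b L L′))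

    Spanned-- : ∀ {x y} → Spanned G x → Spanned G y → Spanned G (λ a b → x a b - y a b)
    Spanned-- {x} {y} Sx Sy = Spanned-≐ (Spanned-+ Sx (Spanned-* (- 1ℚ) Sy))
      λ a b _ → solve 2 (λ u v → u :- v := u :+ (:- con 1ℚ) :* v) refl (x a b) (y a b)

    Spanned-∑ : ∀ {d} (x : Fin d → PairFn n) → (∀ k → Spanned G (x k)) →
      Spanned G (λ a b → sumℚ (λ k → x k a b))
    Spanned-∑ x Sx = List.concat (List.tabulate (proj₁ ∘ Sx)) ,
      AllP.concat⁺ (AllP.tabulate⁺ (proj₁ ∘ proj₂ ∘ Sx)) ,
      λ a b a<b → trans (sumℚ-cong (λ k → proj₂ (proj₂ (Sx k)) a b a<b))
                        (sym (combination-concat a b (proj₁ ∘ Sx)))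

toEdgeVec : ∀ {n} (w : Weights n) → PairFn n → EVec w
toEdgeVec w x e = x (proj₁ (proj₁ e)) (proj₂ (proj₁ e))

Spanned⇒InMaxCutSpace : ∀ {n} {w : Weights n} {G : Subset n → Set} → (∀ {S} → G S → IsMaxCut w S) →
  ∀ {x} → Spanned G x → InMaxCutSpace w (toEdgeVec w x)
Spanned⇒InMaxCutSpace {w = w} G⇒max (L , G-L , x≐L) =
  L , All.map G⇒max G-L , λ e → trans (x≐L _ _ (proj₁ (proj₂ e))) (sym (combo≡combination w L e))

-- Enumerating the edges of K_n

pairCount : ℕ → ℕ
pairCount zero    = 0
pairCount (suc n) = n ℕ.+ pairCount n

pairCount≡C2 : ∀ n → pairCount n ≡ n C 2
pairCount≡C2 zero    = refl
pairCount≡C2 (suc n) = trans (cong₂ ℕ._+_ (sym (nC1≡n n)) (pairCount≡C2 n)) (nCk+nC[k+1]≡[n+1]C[k+1] n 1)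

shiftPair : ∀ {n} → Fin n × Fin n → Fin (suc n) × Fin (suc n)
shiftPair = Product.map F.suc F.suc

mutual
  pairOf : ∀ n → Fin (pairCount n) → Fin n × Fin n
  pairOf (suc n) k = pairOfSplit (splitAt n k)

  pairOfSplit : ∀ {n} → Fin n ⊎ Fin (pairCount n) → Fin (suc n) × Fin (suc n)
  pairOfSplit {n} = [ (λ j → F.zero , F.suc j) , shiftPair ∘ pairOf n ]′

pairOf-< : ∀ n (k : Fin (pairCount n)) → proj₁ (pairOf n k) F.< proj₂ (pairOf n k)
pairOf-< (suc n) k with splitAt n k
... | inj₁ j = s≤s z≤n
... | inj₂ i = s≤s (pairOf-< n i)

pairIndex : ∀ {n} {a b : Fin n} → a F.< b → Fin (pairCount n)
pairIndex {suc n} {F.zero}  {F.suc b} _         = b ↑ˡ pairCount n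
pairIndex {suc n} {F.suc a} {F.suc b} (s≤s a<b) = n ↑ʳ pairIndex a<b

pairOf-pairIndex : ∀ {n} {a b : Fin n} (a<b : a F.< b) → pairOf n (pairIndex a<b) ≡ (a , b)
pairOf-pairIndex {suc n} {F.zero}  {F.suc b} _
  rewrite FinP.splitAt-↑ˡ n b (pairCount n) = refl
pairOf-pairIndex {suc n} {F.suc a} {F.suc b} (s≤s a<b)
  rewrite FinP.splitAt-↑ʳ n (pairCount n) (pairIndex a<b) | pairOf-pairIndex a<b = refl

mutual
  pairOfSplit-injective : ∀ {n} (s s′ : Fin n ⊎ Fin (pairCount n)) → pairOfSplit s ≡ pairOfSplit s′ → s ≡ s′
  pairOfSplit-injective (inj₁ j) (inj₁ j′) eq = cong inj₁ (FinP.suc-injective (cong proj₂ eq))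
  pairOfSplit-injective {n} (inj₂ i) (inj₂ i′) eq = cong inj₂ (pairOf-injective n
    (cong₂ _,_ (FinP.suc-injective (cong proj₁ eq)) (FinP.suc-injective (cong proj₂ eq))))
  pairOfSplit-injective (inj₁ j) (inj₂ i′) ()
  pairOfSplit-injective (inj₂ i) (inj₁ j′) ()

  pairOf-injective : ∀ n {k k′ : Fin (pairCount n)} → pairOf n k ≡ pairOf n k′ → k ≡ k′
  pairOf-injective (suc n) {k} {k′} eq = begin
    k                          ≡⟨ FinP.join-splitAt n (pairCount n) k ⟨
    F.join n _ (splitAt n k)   ≡⟨ cong (F.join n _) (pairOfSplit-injective (splitAt n k) (splitAt n k′) eq) ⟩
    F.join n _ (splitAt n k′)  ≡⟨ FinP.join-splitAt n (pairCount n) k′ ⟩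
    k′                         ∎
    where open ≡-Reasoning

module _ where
  open Q using (_+_; _*_)

  pairVec-self : ∀ {n} (p : Fin n × Fin n) → uncurry (pairVec p) p ≡ 1ℚ
  pairVec-self (x , y) rewrite dec-true (x F.≟ x) refl | dec-true (y F.≟ y) refl = refl

  pairVec-off : ∀ {n} {x y a b : Fin n} → (a , b) ≢ (x , y) → (a , b) ≢ (y , x) → pairVec (x , y) a b ≡ 0ℚ
  pairVec-off {x = x} {y} {a} {b} ≢xy ≢yx with a F.≟ x | b F.≟ y | a F.≟ y | b F.≟ x
  ... | yes refl | yes refl | _        | _        = ⊥-elim (≢xy refl)
  ... | _        | _        | yes refl | yes refl = ⊥-elim (≢yx refl)
  ... | no _     | _        | no _     | _        = refl
  ... | no _     | _        | yes _    | no _     = refl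
  ... | yes _    | no _     | no _     | _        = refl
  ... | yes _    | no _     | yes _    | no _     = refl

  pairVec-pairOf : ∀ n (k k′ : Fin (pairCount n)) →
    uncurry (pairVec (pairOf n k)) (pairOf n k′) ≡ 𝟙 (does (k F.≟ k′))
  pairVec-pairOf n k k′ with k F.≟ k′
  ... | yes refl = pairVec-self (pairOf n k)
  ... | no k≢k′  = pairVec-off (k≢k′ ∘ sym ∘ pairOf-injective n) reversed
    where
    reversed : pairOf n k′ ≢ Product.swap (pairOf n k)
    reversed eq = ℕP.<-asym (pairOf-< n k) (subst (λ p → proj₁ p F.< proj₂ p) eq (pairOf-< n k′))

  sum-pairVec-pairOf : ∀ n (c : Fin (pairCount n) → ℚ) k₀ →
    sumℚ (λ k → c k * uncurry (pairVec (pairOf n k)) (pairOf n k₀)) ≡ c k₀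
  sum-pairVec-pairOf n c k₀ = trans (sumℚ-cong (λ k → cong (c k *_) (pairVec-pairOf n k k₀))) (sumℚ-𝟙-≟ c k₀)

  sum-pairVec : ∀ {n} (f : Fin n → Fin n → ℚ) {a b} → a F.< b →
    sumℚ (λ k → uncurry f (pairOf n k) * pairVec (pairOf n k) a b) ≡ f a b
  sum-pairVec {n} f {a} {b} a<b = begin
    sumℚ (λ k → uncurry f (pairOf n k) * pairVec (pairOf n k) a b)
      ≡⟨ sumℚ-cong (λ k → cong (λ p → uncurry f (pairOf n k) * uncurry (pairVec (pairOf n k)) p) (sym (pairOf-pairIndex a<b))) ⟩
    sumℚ (λ k → uncurry f (pairOf n k) * uncurry (pairVec (pairOf n k)) (pairOf n i))
      ≡⟨ sum-pairVec-pairOf n (uncurry f ∘ pairOf n) i ⟩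
    uncurry f (pairOf n i)
      ≡⟨ cong (uncurry f) (pairOf-pairIndex a<b) ⟩
    f a b ∎
    where
    open ≡-Reasoning
    i = pairIndex a<b

  sum-pairOf-suc : ∀ n (g : Fin (suc n) × Fin (suc n) → ℚ) →
    sumℚ (λ k → g (pairOf (suc n) k)) ≡ sumℚ (λ j → g (F.zero , F.suc j)) + sumℚ (λ k → g (shiftPair (pairOf n k)))
  sum-pairOf-suc n g = trans (sumℚ-↑ n (g ∘ pairOf (suc n)))
    (cong₂ _+_ (sumℚ-cong (λ j → cong (g ∘ pairOfSplit) (FinP.splitAt-↑ˡ n j (pairCount n))))
               (sumℚ-cong (λ k → cong (g ∘ pairOfSplit) (FinP.splitAt-↑ʳ n (pairCount n) k))))

  sum-𝟙-xor : ∀ {n} s (S : Subset n) → sumℚ (λ j → 𝟙 (s xor lookup S j)) ≡ (if s then ∣ ∁ S ∣ else ∣ S ∣) · 1ℚ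
  sum-𝟙-xor true  []          = refl
  sum-𝟙-xor false []          = refl
  sum-𝟙-xor true  (true  ∷ S) = trans (ℚP.+-identityˡ _) (sum-𝟙-xor true S)
  sum-𝟙-xor true  (false ∷ S) = cong (1ℚ +_) (sum-𝟙-xor true S)
  sum-𝟙-xor false (true  ∷ S) = cong (1ℚ +_) (sum-𝟙-xor false S)
  sum-𝟙-xor false (false ∷ S) = trans (ℚP.+-identityˡ _) (sum-𝟙-xor false S)

  count-cut-pairs : ∀ {n} (S : Subset n) →
    sumℚ (λ k → uncurry (cutVec S) (pairOf n k)) ≡ (∣ S ∣ ℕ.* ∣ ∁ S ∣) · 1ℚ
  count-cut-pairs {zero}  []      = refl
  count-cut-pairs {suc n} (s ∷ S) = begin
    sumℚ (λ k → uncurry (cutVec (s ∷ S)) (pairOf (suc n) k))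
      ≡⟨ sum-pairOf-suc n (uncurry (cutVec (s ∷ S))) ⟩
    sumℚ (λ j → 𝟙 (s xor lookup S j)) + sumℚ (λ k → uncurry (cutVec S) (pairOf n k))
      ≡⟨ cong₂ _+_ (sum-𝟙-xor s S) (count-cut-pairs S) ⟩
    (if s then ∣ ∁ S ∣ else ∣ S ∣) · 1ℚ + (∣ S ∣ ℕ.* ∣ ∁ S ∣) · 1ℚ
      ≡⟨ ×-homo-+ 1ℚ (if s then ∣ ∁ S ∣ else ∣ S ∣) _ ⟨
    ((if s then ∣ ∁ S ∣ else ∣ S ∣) ℕ.+ ∣ S ∣ ℕ.* ∣ ∁ S ∣) · 1ℚ
      ≡⟨ cong (_· 1ℚ) (product-step s) ⟩
    (∣ s ∷ S ∣ ℕ.* ∣ ∁ (s ∷ S) ∣) · 1ℚ ∎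
    where
    open ≡-Reasoning
    product-step : ∀ s → (if s then ∣ ∁ S ∣ else ∣ S ∣) ℕ.+ ∣ S ∣ ℕ.* ∣ ∁ S ∣ ≡ ∣ s ∷ S ∣ ℕ.* ∣ ∁ (s ∷ S) ∣
    product-step true  = refl
    product-step false = sym (ℕP.*-suc ∣ S ∣ ∣ ∁ S ∣)

-- Cuts of K_n

module _ where
  open import Data.Nat using (_+_; _*_; ∣_-_∣)

  ∣S∣+∣∁S∣≡n : ∀ {n} (S : Subset n) → ∣ S ∣ + ∣ ∁ S ∣ ≡ n
  ∣S∣+∣∁S∣≡n S = trans (cong (∣ S ∣ +_) (SubsetP.∣∁p∣≡n∸∣p∣ S)) (ℕP.m+[n∸m]≡n (SubsetP.∣p∣≤n S))

  ∣∁S∣-of-∣S∣ : ∀ {n a b} (S : Subset n) → n ≡ a + b → ∣ S ∣ ≡ a → ∣ ∁ S ∣ ≡ b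
  ∣∁S∣-of-∣S∣ {a = a} S n≡a+b ∣S∣≡a =
    ℕP.+-cancelˡ-≡ a _ _ (trans (cong (_+ ∣ ∁ S ∣) (sym ∣S∣≡a)) (trans (∣S∣+∣∁S∣≡n S) n≡a+b))

  subset-of-size : ∀ {n} (A : Subset n) {k} → k ≤ ∣ A ∣ → ∃[ S ] S ⊆ A × ∣ S ∣ ≡ k
  subset-of-size []          {zero}  _         = [] , (λ ()) , refl
  subset-of-size (true  ∷ A) {zero}  _         with subset-of-size A z≤n
  ... | S , S⊆A , ∣S∣≡0 = false ∷ S , SubsetP.out⊆ S⊆A , ∣S∣≡0
  subset-of-size (true  ∷ A) {suc k} (s≤s k≤A) with subset-of-size A k≤A
  ... | S , S⊆A , ∣S∣≡k = true ∷ S , SubsetP.in⊆in S⊆A , cong suc ∣S∣≡k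
  subset-of-size (false ∷ A) {k}     k≤A       with subset-of-size A k≤A
  ... | S , S⊆A , ∣S∣≡k = false ∷ S , SubsetP.out⊆ S⊆A , ∣S∣≡k

  private
    sumℕ-cong : ∀ {d} {f g : Fin d → ℕ} → (∀ k → f k ≡ g k) → sumℕ f ≡ sumℕ g
    sumℕ-cong {zero}  f≗g = refl
    sumℕ-cong {suc d} f≗g = cong₂ _+_ (f≗g F.zero) (sumℕ-cong (f≗g ∘ F.suc))

    sumℕ-zero : ∀ d → sumℕ {d} (λ _ → 0) ≡ 0
    sumℕ-zero zero    = refl
    sumℕ-zero (suc d) = sumℕ-zero d

    count-outside : ∀ {n} (S : Subset n) → sumℕ (λ j → if not (lookup S j) then 1 else 0) ≡ ∣ ∁ S ∣
    count-outside []          = refl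
    count-outside (true  ∷ S) = count-outside S
    count-outside (false ∷ S) = cong suc (count-outside S)

    sum-over-members : ∀ {n} (S : Subset n) c → sumℕ (λ i → if lookup S i then c else 0) ≡ ∣ S ∣ * c
    sum-over-members []          c = refl
    sum-over-members (true  ∷ S) c = cong (c +_) (sum-over-members S c)
    sum-over-members (false ∷ S) c = sum-over-members S c

  cut-complete : ∀ {n} (S : Subset n) → cut (completeGraph n) S ≡ ∣ S ∣ * ∣ ∁ S ∣
  cut-complete {n} S = trans (sumℕ-cong (row ∘ lookup S)) (sum-over-members S ∣ ∁ S ∣)
    where
    row : ∀ s → sumℕ (λ j → if s ∧ not (lookup S j) then 1 else 0) ≡ (if s then ∣ ∁ S ∣ else 0)
    row true  = count-outside S
    row false = sumℕ-zero n

  private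
    four-mul+square : ∀ k z → k ≤ z → 4 * (k * z) + (z ∸ k) * (z ∸ k) ≡ (k + z) * (k + z)
    four-mul+square k z k≤z with z ∸ k | ℕP.m+[n∸m]≡n k≤z
    ... | d | refl = solve 2 (λ k d → con 4 :* (k :* (k :+ d)) :+ d :* d := (k :+ (k :+ d)) :* (k :+ (k :+ d))) refl k d
      where open ℕSolver.+-*-Solver

  four-mul+dist² : ∀ k z → 4 * (k * z) + ∣ k - z ∣ * ∣ k - z ∣ ≡ (k + z) * (k + z)
  four-mul+dist² k z with ℕP.≤-total k z
  ... | inj₁ k≤z rewrite ℕP.m≤n⇒∣m-n∣≡n∸m k≤z = four-mul+square k z k≤z
  ... | inj₂ z≤k rewrite ℕP.∣-∣-comm k z | ℕP.m≤n⇒∣m-n∣≡n∸m z≤k | ℕP.*-comm k z | ℕP.+-comm k z =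
    four-mul+square z k z≤k

  private
    2*k≡k+k : ∀ k → 2 * k ≡ k + k
    2*k≡k+k k = cong (k +_) (ℕP.+-identityʳ k)

    double-injective : ∀ {k h} → k + k ≡ h + h → k ≡ h
    double-injective {k} {h} eq = ℕP.*-cancelˡ-≡ k h 2 (trans (2*k≡k+k k) (trans eq (sym (2*k≡k+k h))))

    double≢odd : ∀ k m → k + k ≢ suc (m + m)
    double≢odd k m eq = ℕP.even≢odd k m (trans (2*k≡k+k k) (trans eq (cong suc (sym (2*k≡k+k m)))))

  product-bound-even : ∀ h k z → k + z ≡ h + h → k * z ≤ h * h
  product-bound-even h k z k+z≡2h = ℕP.*-cancelˡ-≤ 4 (begin
    4 * (k * z)                                ≤⟨ ℕP.m≤m+n _ _ ⟩
    4 * (k * z) + ∣ k - z ∣ * ∣ k - z ∣        ≡⟨ four-mul+dist² k z ⟩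
    (k + z) * (k + z)                          ≡⟨ cong (λ s → s * s) k+z≡2h ⟩
    (h + h) * (h + h)                          ≡⟨ solve 1 (λ h → (h :+ h) :* (h :+ h) := con 4 :* (h :* h)) refl h ⟩
    4 * (h * h)                                ∎)
    where
    open ℕP.≤-Reasoning
    open ℕSolver.+-*-Solver

  product-eq-even : ∀ h k z → k + z ≡ h + h → h * h ≤ k * z → k ≡ h
  product-eq-even h k z k+z≡2h hh≤kz = double-injective (trans (cong (k +_) k≡z) k+z≡2h)
    where
    open ℕSolver.+-*-Solver
    total : 4 * (k * z) + ∣ k - z ∣ * ∣ k - z ∣ ≡ 4 * (h * h)
    total = trans (four-mul+dist² k z) (trans (cong (λ s → s * s) k+z≡2h)
      (solve 1 (λ h → (h :+ h) :* (h :+ h) := con 4 :* (h :* h)) refl h))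
    dist²≤0 : ∣ k - z ∣ * ∣ k - z ∣ ≤ 0
    dist²≤0 = ℕP.+-cancelˡ-≤ (4 * (k * z)) _ _ (begin
      4 * (k * z) + ∣ k - z ∣ * ∣ k - z ∣  ≡⟨ total ⟩
      4 * (h * h)                          ≤⟨ ℕP.*-monoʳ-≤ 4 hh≤kz ⟩
      4 * (k * z)                          ≡⟨ ℕP.+-identityʳ _ ⟨
      4 * (k * z) + 0                      ∎)
      where open ℕP.≤-Reasoning
    k≡z : k ≡ z
    k≡z with ℕP.m*n≡0⇒m≡0∨n≡0 ∣ k - z ∣ (ℕP.n≤0⇒n≡0 dist²≤0)
    ... | inj₁ dist≡0 = ℕP.∣m-n∣≡0⇒m≡n dist≡0
    ... | inj₂ dist≡0 = ℕP.∣m-n∣≡0⇒m≡n dist≡0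

  product-bound-odd : ∀ m k z → k + z ≡ suc (m + m) → k * z ≤ m * suc m
  product-bound-odd m k z k+z≡2m+1 with ∣ k - z ∣ in dist
  ... | zero  = ⊥-elim (double≢odd k m (subst (λ y → k + y ≡ _) (sym (ℕP.∣m-n∣≡0⇒m≡n dist)) k+z≡2m+1))
  ... | suc d = ℕP.*-cancelˡ-≤ 4 (ℕP.+-cancelʳ-≤ 1 _ _ (begin
    4 * (k * z) + 1                      ≤⟨ ℕP.+-monoʳ-≤ (4 * (k * z)) (s≤s z≤n) ⟩
    4 * (k * z) + suc d * suc d          ≡⟨ subst (λ e → 4 * (k * z) + e * e ≡ (k + z) * (k + z)) dist (four-mul+dist² k z) ⟩
    (k + z) * (k + z)                    ≡⟨ cong (λ s → s * s) k+z≡2m+1 ⟩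
    suc (m + m) * suc (m + m)            ≡⟨ solve 1 (λ m → (con 1 :+ (m :+ m)) :* (con 1 :+ (m :+ m)) := con 4 :* (m :* (con 1 :+ m)) :+ con 1) refl m ⟩
    4 * (m * suc m) + 1                  ∎))
    where
    open ℕP.≤-Reasoning
    open ℕSolver.+-*-Solver

  NearHalf : ∀ {n} → ℕ → Subset n → Set
  NearHalf m S = ∣ S ∣ ≡ m ⊎ ∣ S ∣ ≡ suc m

  private
    cut-NearHalf : ∀ {m n} → n ≡ suc (m + m) → (S : Subset n) → NearHalf m S →
      cut (completeGraph n) S ≡ m * suc m
    cut-NearHalf {m} n≡2m+1 S (inj₁ ∣S∣≡m) = trans (cut-complete S)
      (cong₂ _*_ ∣S∣≡m (∣∁S∣-of-∣S∣ S (trans n≡2m+1 (sym (ℕP.+-suc m m))) ∣S∣≡m))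
    cut-NearHalf {m} n≡2m+1 S (inj₂ ∣S∣≡1+m) = trans (cut-complete S)
      (trans (cong₂ _*_ ∣S∣≡1+m (∣∁S∣-of-∣S∣ S n≡2m+1 ∣S∣≡1+m)) (ℕP.*-comm (suc m) m))

    cut-balanced : ∀ {h n} → n ≡ h + h → (S : Subset n) → ∣ S ∣ ≡ h → cut (completeGraph n) S ≡ h * h
    cut-balanced n≡2h S ∣S∣≡h =
      trans (cut-complete S) (cong₂ _*_ ∣S∣≡h (∣∁S∣-of-∣S∣ S n≡2h ∣S∣≡h))

  isMaxCut-odd : ∀ {m n} → n ≡ suc (m + m) → (S : Subset n) → NearHalf m S → IsMaxCut (completeGraph n) S
  isMaxCut-odd {m} n≡2m+1 S S-near T = begin
    cut (completeGraph _) T  ≡⟨ cut-complete T ⟩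
    ∣ T ∣ * ∣ ∁ T ∣           ≤⟨ product-bound-odd m ∣ T ∣ ∣ ∁ T ∣ (trans (∣S∣+∣∁S∣≡n T) n≡2m+1) ⟩
    m * suc m                ≡⟨ cut-NearHalf n≡2m+1 S S-near ⟨
    cut (completeGraph _) S  ∎
    where open ℕP.≤-Reasoning

  isMaxCut-even : ∀ {h n} → n ≡ h + h → (S : Subset n) → ∣ S ∣ ≡ h → IsMaxCut (completeGraph n) S
  isMaxCut-even {h} n≡2h S ∣S∣≡h T = begin
    cut (completeGraph _) T  ≡⟨ cut-complete T ⟩
    ∣ T ∣ * ∣ ∁ T ∣           ≤⟨ product-bound-even h ∣ T ∣ ∣ ∁ T ∣ (trans (∣S∣+∣∁S∣≡n T) n≡2h) ⟩
    h * h                    ≡⟨ cut-balanced n≡2h S ∣S∣≡h ⟨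
    cut (completeGraph _) S  ∎
    where open ℕP.≤-Reasoning

  maxCut-even-size : ∀ {h n} → n ≡ h + h → (U : Subset n) → IsMaxCut (completeGraph n) U → ∣ U ∣ ≡ h
  maxCut-even-size {h} {n} n≡2h U U-max = product-eq-even h ∣ U ∣ ∣ ∁ U ∣ (trans (∣S∣+∣∁S∣≡n U) n≡2h) (begin
    h * h                    ≡⟨ cut-balanced n≡2h S ∣S∣≡h ⟨
    cut (completeGraph n) S  ≤⟨ U-max S ⟩
    cut (completeGraph n) U  ≡⟨ cut-complete U ⟩
    ∣ U ∣ * ∣ ∁ U ∣           ∎)
    where
    open ℕP.≤-Reasoning
    h≤∣⊤∣ : h ≤ ∣ ⊤ {n} ∣
    h≤∣⊤∣ = subst (h ≤_) (sym (trans (SubsetP.∣⊤∣≡n n) n≡2h)) (ℕP.m≤m+n h h)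
    S = proj₁ (subset-of-size (⊤ {n}) h≤∣⊤∣)
    ∣S∣≡h = proj₂ (proj₂ (subset-of-size (⊤ {n}) h≤∣⊤∣))

-- Odd n: every edge vector is spanned by maximum cuts

lookup-⁅⁆ : ∀ {n} (x a : Fin n) → lookup ⁅ x ⁆ a ≡ does (a F.≟ x)
lookup-⁅⁆ F.zero    F.zero    = refl
lookup-⁅⁆ F.zero    (F.suc a) = VecP.lookup-replicate a false
lookup-⁅⁆ (F.suc x) F.zero    = refl
lookup-⁅⁆ (F.suc x) (F.suc a) = lookup-⁅⁆ x a

lookup-∪⁅⁆ : ∀ {n} (S : Subset n) x a → lookup (S ∪ ⁅ x ⁆) a ≡ lookup S a ∨ does (a F.≟ x)
lookup-∪⁅⁆ S x a = trans (VecP.lookup-zipWith _∨_ a S ⁅ x ⁆) (cong (lookup S a ∨_) (lookup-⁅⁆ x a))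

∣S∪⁅x⁆∣ : ∀ {n} (S : Subset n) {x} → lookup S x ≡ false → ∣ S ∪ ⁅ x ⁆ ∣ ≡ suc ∣ S ∣
∣S∪⁅x⁆∣ (false ∷ S) {F.zero}  _      = cong suc (cong ∣_∣ (SubsetP.∪-identityʳ S))
∣S∪⁅x⁆∣ (true  ∷ S) {F.suc x} S[x]≡f = cong suc (∣S∪⁅x⁆∣ S S[x]≡f)
∣S∪⁅x⁆∣ (false ∷ S) {F.suc x} S[x]≡f = ∣S∪⁅x⁆∣ S S[x]≡f

⊆∁-lookup : ∀ {n} {S B : Subset n} → S ⊆ ∁ B → ∀ {x} → x ∈ B → lookup S x ≡ false
⊆∁-lookup {S = S} S⊆∁B {x} x∈B with lookup S x in S[x]
... | false = refl
... | true  = contradiction (S⊆∁B (VecP.lookup⇒[]= x S S[x])) (SubsetP.x∈p⇒x∉∁p x∈B)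

avoiding-three : ∀ {n} m′ → 3 ℕ.+ m′ ≤ n → ∀ {j l p : Fin n} → j ≢ l → j ≢ p → l ≢ p →
  ∃[ S ] ∣ S ∣ ≡ m′ × lookup S j ≡ false × lookup S l ≡ false × lookup S p ≡ false
avoiding-three {n} m′ room {j} {l} {p} j≢l j≢p l≢p =
  S , ∣S∣≡m′ , ⊆∁-lookup S⊆∁B (x∈p∪q⁺ (inj₁ (x∈p∪q⁺ (inj₁ (x∈⁅x⁆ j))))) ,
               ⊆∁-lookup S⊆∁B (x∈p∪q⁺ (inj₁ (x∈p∪q⁺ (inj₂ (x∈⁅x⁆ l))))) ,
               ⊆∁-lookup S⊆∁B (x∈p∪q⁺ (inj₂ (x∈⁅x⁆ p)))
  where
  open SubsetP using (x∈p∪q⁺; x∈⁅x⁆)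
  B = (⁅ j ⁆ ∪ ⁅ l ⁆) ∪ ⁅ p ⁆
  ∣B∣≡3 : ∣ B ∣ ≡ 3
  ∣B∣≡3 = trans (∣S∪⁅x⁆∣ (⁅ j ⁆ ∪ ⁅ l ⁆) p∉) (cong suc (trans (∣S∪⁅x⁆∣ ⁅ j ⁆ l∉) (cong suc (SubsetP.∣⁅x⁆∣≡1 j))))
    where
    l∉ : lookup ⁅ j ⁆ l ≡ false
    l∉ = trans (lookup-⁅⁆ j l) (dec-false (l F.≟ j) (j≢l ∘ sym))
    p∉ : lookup (⁅ j ⁆ ∪ ⁅ l ⁆) p ≡ false
    p∉ = trans (lookup-∪⁅⁆ ⁅ j ⁆ l p) (cong₂ _∨_ (trans (lookup-⁅⁆ j p) (dec-false (p F.≟ j) (j≢p ∘ sym)))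
                                                (dec-false (p F.≟ l) (l≢p ∘ sym)))
  room′ : m′ ≤ ∣ ∁ B ∣
  room′ = subst (m′ ≤_) (sym (trans (SubsetP.∣∁p∣≡n∸∣p∣ B) (cong (n ∸_) ∣B∣≡3))) (ℕP.m+n≤o⇒m≤o∸n m′ (subst (_≤ n) (ℕP.+-comm 3 m′) room))
  S = proj₁ (subset-of-size (∁ B) room′)
  S⊆∁B = proj₁ (proj₂ (subset-of-size (∁ B) room′))
  ∣S∣≡m′ = proj₂ (proj₂ (subset-of-size (∁ B) room′))

module _ where
  open Q using (_+_; _*_; _-_; -_; ½)
  open ℚSolver.+-*-Solver

  -- The profile of a vertex a records a ∈ S₀, a ≡ j, a ≡ l and a ≡ p.
  Profile : Set
  Profile = Bool × Bool × Bool × Bool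

  data Role : Set where
    centre left right : Role
    elsewhere         : Bool → Role

  roleProfile : Role → Profile
  roleProfile centre        = false , true  , false , false
  roleProfile left          = false , false , true  , false
  roleProfile right         = false , false , false , true
  roleProfile (elsewhere s) = s     , false , false , false

  -- v(S₀∪{l}) - v(S₀∪{l,j}) - v(S₀∪{p}) + v(S₀∪{p,j}) and 2 (e_jl - e_jp) at a pair, in terms of
  -- the profiles of its endpoints.
  starCombination : Profile → Profile → ℚ
  starCombination (s , cj , cl , cp) (s′ , cj′ , cl′ , cp′) =
    1ℚ * 𝟙 ((s ∨ cl) xor (s′ ∨ cl′)) + (- 1ℚ * 𝟙 (((s ∨ cl) ∨ cj) xor ((s′ ∨ cl′) ∨ cj′)) +
    (- 1ℚ * 𝟙 ((s ∨ cp) xor (s′ ∨ cp′)) + (1ℚ * 𝟙 (((s ∨ cp) ∨ cj) xor ((s′ ∨ cp′) ∨ cj′)) + 0ℚ)))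

  starTarget : Profile → Profile → ℚ
  starTarget (_ , cj , cl , cp) (_ , cj′ , cl′ , cp′) =
    (1ℚ + 1ℚ) * (𝟙 ((cj ∧ cl′) ∨ (cl ∧ cj′)) - 𝟙 ((cj ∧ cp′) ∨ (cp ∧ cj′)))

  star-identity : ∀ r r′ → starCombination (roleProfile r) (roleProfile r′) ≡ starTarget (roleProfile r) (roleProfile r′)
  star-identity centre            centre            = refl
  star-identity centre            left              = refl
  star-identity centre            right             = refl
  star-identity centre            (elsewhere true)  = refl
  star-identity centre            (elsewhere false) = refl
  star-identity left              centre            = refl
  star-identity left              left              = refl
  star-identity left              right             = refl
  star-identity left              (elsewhere true)  = refl
  star-identity left              (elsewhere false) = refl
  star-identity right             centre            = refl
  star-identity right             left              = refl
  star-identity right             right             = refl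
  star-identity right             (elsewhere true)  = refl
  star-identity right             (elsewhere false) = refl
  star-identity (elsewhere true)  centre            = refl
  star-identity (elsewhere true)  left              = refl
  star-identity (elsewhere true)  right             = refl
  star-identity (elsewhere true)  (elsewhere true)  = refl
  star-identity (elsewhere true)  (elsewhere false) = refl
  star-identity (elsewhere false) centre            = refl
  star-identity (elsewhere false) left              = refl
  star-identity (elsewhere false) right             = refl
  star-identity (elsewhere false) (elsewhere true)  = refl
  star-identity (elsewhere false) (elsewhere false) = refl

  star-spanned : ∀ {n} m′ → 3 ℕ.+ m′ ≤ n → ∀ {j l p : Fin n} → j ≢ l → j ≢ p → l ≢ p →
    Spanned (NearHalf (suc m′)) (λ a b → pairVec (j , l) a b - pairVec (j , p) a b)
  star-spanned {n} m′ room {j} {l} {p} j≢l j≢p l≢p with avoiding-three m′ room j≢l j≢p l≢p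
  ... | S₀ , ∣S₀∣≡m′ , S₀[j] , S₀[l] , S₀[p] =
    Spanned-≐ (Spanned-* ½ (L , L-near , λ _ _ _ → refl)) halve
    where
    T₁ T₂ T₃ T₄ : Subset n
    T₁ = S₀ ∪ ⁅ l ⁆
    T₂ = T₁ ∪ ⁅ j ⁆
    T₃ = S₀ ∪ ⁅ p ⁆
    T₄ = T₃ ∪ ⁅ j ⁆

    L : List (ℚ × Subset n)
    L = (1ℚ , T₁) ∷ (- 1ℚ , T₂) ∷ (- 1ℚ , T₃) ∷ (1ℚ , T₄) ∷ []

    ∣T₁∣ : ∣ T₁ ∣ ≡ suc m′
    ∣T₁∣ = trans (∣S∪⁅x⁆∣ S₀ S₀[l]) (cong suc ∣S₀∣≡m′)
    ∣T₃∣ : ∣ T₃ ∣ ≡ suc m′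
    ∣T₃∣ = trans (∣S∪⁅x⁆∣ S₀ S₀[p]) (cong suc ∣S₀∣≡m′)
    ∣T₂∣ : ∣ T₂ ∣ ≡ suc (suc m′)
    ∣T₂∣ = trans (∣S∪⁅x⁆∣ T₁ (trans (lookup-∪⁅⁆ S₀ l j) (cong₂ _∨_ S₀[j] (dec-false (j F.≟ l) j≢l))))
                 (cong suc ∣T₁∣)
    ∣T₄∣ : ∣ T₄ ∣ ≡ suc (suc m′)
    ∣T₄∣ = trans (∣S∪⁅x⁆∣ T₃ (trans (lookup-∪⁅⁆ S₀ p j) (cong₂ _∨_ S₀[j] (dec-false (j F.≟ p) j≢p))))
                 (cong suc ∣T₃∣)

    L-near : All (NearHalf (suc m′) ∘ proj₂) L
    L-near = inj₁ ∣T₁∣ ∷ inj₂ ∣T₂∣ ∷ inj₁ ∣T₃∣ ∷ inj₂ ∣T₄∣ ∷ []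

    profile : Fin n → Profile
    profile a = lookup S₀ a , does (a F.≟ j) , does (a F.≟ l) , does (a F.≟ p)

    classify : ∀ a → ∃[ r ] (lookup S₀ a , does (a F.≟ j) , does (a F.≟ l) , does (a F.≟ p)) ≡ roleProfile r
    classify a with a F.≟ j | a F.≟ l | a F.≟ p
    ... | yes refl | yes refl | _        = ⊥-elim (j≢l refl)
    ... | yes refl | no _     | yes refl = ⊥-elim (j≢p refl)
    ... | yes refl | no _     | no _     = centre , cong (_, true , false , false) S₀[j]
    ... | no _     | yes refl | yes refl = ⊥-elim (l≢p refl)
    ... | no _     | yes refl | no _     = left , cong (_, false , true , false) S₀[l]
    ... | no _     | no _     | yes refl = right , cong (_, false , false , true) S₀[p]
    ... | no _     | no _     | no _     = elsewhere (lookup S₀ a) , refl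

    combination-profile : ∀ a b → combination L a b ≡ starCombination (profile a) (profile b)
    combination-profile a b
      rewrite lookup-∪⁅⁆ T₁ j a | lookup-∪⁅⁆ T₁ j b | lookup-∪⁅⁆ T₃ j a | lookup-∪⁅⁆ T₃ j b
            | lookup-∪⁅⁆ S₀ l a | lookup-∪⁅⁆ S₀ l b | lookup-∪⁅⁆ S₀ p a | lookup-∪⁅⁆ S₀ p b = refl

    profile-identity : ∀ a b → starCombination (profile a) (profile b) ≡ starTarget (profile a) (profile b)
    profile-identity a b with classify a | classify b
    ... | r , a-role | r′ , b-role =
      subst₂ (λ x y → starCombination x y ≡ starTarget x y) (sym a-role) (sym b-role) (star-identity r r′)

    halve : (λ a b → pairVec (j , l) a b - pairVec (j , p) a b) ≐ (λ a b → ½ * combination L a b)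
    halve a b _ = begin
      pairVec (j , l) a b - pairVec (j , p) a b      ≡⟨ solve 1 (λ x → x := con ½ :* ((con 1ℚ :+ con 1ℚ) :* x)) refl _ ⟩
      ½ * starTarget (profile a) (profile b)         ≡⟨ cong (½ *_) (profile-identity a b) ⟨
      ½ * starCombination (profile a) (profile b)    ≡⟨ cong (½ *_) (combination-profile a b) ⟨
      ½ * combination L a b                          ∎
      where open ≡-Reasoning

  fan-spanned : ∀ {n} m′ → 3 ℕ.+ m′ ≤ n → ∀ {j l p : Fin n} → j ≢ l → j ≢ p →
    Spanned (NearHalf (suc m′)) (λ a b → pairVec (j , l) a b - pairVec (j , p) a b)
  fan-spanned m′ room {j} {l} {p} j≢l j≢p with l F.≟ p
  ... | yes refl = Spanned-≐ Spanned-0 (λ a b _ → ℚP.+-inverseʳ (pairVec (j , l) a b))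
  ... | no l≢p   = star-spanned m′ room j≢l j≢p l≢p

  difference-spanned : ∀ {n} m′ → 3 ℕ.+ m′ ≤ n → ∀ {x y i j : Fin n} → x ≢ y → i ≢ j →
    Spanned (NearHalf (suc m′)) (λ a b → pairVec (x , y) a b - pairVec (i , j) a b)
  difference-spanned m′ room {x} {y} {i} {j} x≢y i≢j with x F.≟ i
  ... | yes refl = fan-spanned m′ room x≢y i≢j
  ... | no x≢i   = Spanned-≐ (Spanned-+ (fan-spanned m′ room x≢y x≢i) (fan-spanned m′ room (x≢i ∘ sym) i≢j))
    λ a b _ → trans (solve 3 (λ u v w → u :- w := u :- v :+ (v :- w)) refl (pairVec (x , y) a b) (pairVec (x , i) a b) (pairVec (i , j) a b))
                    (cong (λ t → pairVec (x , y) a b - pairVec (x , i) a b + (t - pairVec (i , j) a b)) (pairVec-sym x i a b))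

  -- v_{S₀} - Σ_k v_{S₀}(k) (e_k - e_ij) = (Σ_k v_{S₀}(k)) e_ij, and the coefficient counts the
  -- pairs cut by S₀.
  pairVec-spanned : ∀ {n} m′ → 3 ℕ.+ m′ ≤ n → ∀ {i j : Fin n} → i ≢ j →
    Spanned (NearHalf (suc m′)) (pairVec (i , j))
  pairVec-spanned {n} m′ room {i} {j} i≢j = Spanned-≐
    (Spanned-* (Q.1/ total) (Spanned-- (Spanned-cutVec {S = S₀} (inj₁ ∣S₀∣≡1+m′))
      (Spanned-∑ (λ k a b → v k * (pairVec (pairOf n k) a b - pairVec (i , j) a b))
                 (λ k → Spanned-* (v k) (difference-spanned m′ room (FinP.<⇒≢ (pairOf-< n k)) i≢j)))))
    isolate
    where
    1+m′≤∣⊤∣ : suc m′ ≤ ∣ ⊤ {n} ∣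
    1+m′≤∣⊤∣ = subst (suc m′ ≤_) (sym (SubsetP.∣⊤∣≡n n)) (ℕP.≤-trans (ℕP.n≤1+n _) (ℕP.<⇒≤ room))
    S₀ = proj₁ (subset-of-size (⊤ {n}) 1+m′≤∣⊤∣)
    ∣S₀∣≡1+m′ = proj₂ (proj₂ (subset-of-size (⊤ {n}) 1+m′≤∣⊤∣))

    v : Fin (pairCount n) → ℚ
    v k = uncurry (cutVec S₀) (pairOf n k)

    total : ℚ
    total = sumℚ v

    total≢0 : total ≢ 0ℚ
    total≢0 = subst (_≢ 0ℚ) (sym (count-cut-pairs S₀)) (product·1≢0
      (subst (0 ℕ.<_) (sym ∣S₀∣≡1+m′) (s≤s z≤n))
      (subst (0 ℕ.<_) (sym (trans (SubsetP.∣∁p∣≡n∸∣p∣ S₀) (cong (n ∸_) ∣S₀∣≡1+m′))) (ℕP.m<n⇒0<n∸m (ℕP.<⇒≤ room))))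

    instance
      total-nonZero : Q.NonZero total
      total-nonZero = Q.≢-nonZero total≢0

    isolate : pairVec (i , j) ≐
      (λ a b → Q.1/ total * (cutVec S₀ a b - sumℚ (λ k → v k * (pairVec (pairOf n k) a b - pairVec (i , j) a b))))
    isolate a b a<b = begin
      d                                              ≡⟨ ℚP.*-identityˡ d ⟨
      1ℚ * d                                         ≡⟨ cong (_* d) (ℚP.*-inverseˡ total) ⟨
      Q.1/ total * total * d                         ≡⟨ solve 4 (λ r u t d → r :* (u :- (u :+ (:- d) :* t)) := r :* t :* d) refl
                                                               (Q.1/ total) (cutVec S₀ a b) total d ⟨
      Q.1/ total * (cutVec S₀ a b - (cutVec S₀ a b + - d * total))
                                                     ≡⟨ cong (λ s → Q.1/ total * (cutVec S₀ a b - s)) expand ⟨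
      Q.1/ total * (cutVec S₀ a b - sumℚ (λ k → v k * (pairVec (pairOf n k) a b - d))) ∎
      where
      open ≡-Reasoning
      d = pairVec (i , j) a b
      expand : sumℚ (λ k → v k * (pairVec (pairOf n k) a b - d)) ≡ cutVec S₀ a b + - d * total
      expand = begin
        sumℚ (λ k → v k * (pairVec (pairOf n k) a b - d))
          ≡⟨ sumℚ-cong (λ k → solve 3 (λ v x d → v :* (x :- d) := v :* x :+ (:- d) :* v) refl (v k) _ d) ⟩
        sumℚ (λ k → v k * pairVec (pairOf n k) a b + - d * v k)
          ≡⟨ sumℚ-+ (λ k → v k * pairVec (pairOf n k) a b) (λ k → - d * v k) ⟩
        sumℚ (λ k → v k * pairVec (pairOf n k) a b) + sumℚ (λ k → - d * v k)
          ≡⟨ cong₂ _+_ (sum-pairVec (cutVec S₀) a<b) (sumℚ-*ˡ (- d) v) ⟩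
        cutVec S₀ a b + - d * total ∎

maxCutDim-odd : ∀ m n → n ≡ suc (suc m ℕ.+ suc m) → MaxCutDim (completeGraph n) (pairCount n)
maxCutDim-odd m n n≡2m+3 = basis , basis-in-space , basis-independent , basis-spans
  where
  w = completeGraph n

  room : 3 ℕ.+ m ≤ n
  room = subst (3 ℕ.+ m ≤_) (sym n≡2m+3) (s≤s (s≤s (ℕP.m≤n+m (suc m) m)))

  basis : Fin (pairCount n) → EVec w
  basis k = toEdgeVec w (pairVec (pairOf n k))

  edgeOf : Fin (pairCount n) → Edge w
  edgeOf k = pairOf n k , pairOf-< n k , s≤s z≤n

  basis-in-space : ∀ k → InMaxCutSpace w (basis k)
  basis-in-space k = Spanned⇒InMaxCutSpace (λ {S} → isMaxCut-odd n≡2m+3 S) (pairVec-spanned m room (FinP.<⇒≢ (pairOf-< n k)))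

  basis-independent : LinIndep w basis
  basis-independent c ∑≡0 k₀ = begin
    c k₀                                                            ≡⟨ sum-pairVec-pairOf n c k₀ ⟨
    sumℚ (λ k → c k Q.* uncurry (pairVec (pairOf n k)) (pairOf n k₀)) ≡⟨ sumℚ-cong (λ k → cong (c k Q.*_) (at-edge k)) ⟩
    sumℚ (λ k → c k Q.* basis k (edgeOf k₀))                         ≡⟨ ∑≡0 (edgeOf k₀) ⟩
    0ℚ                                                              ∎
    where
    open ≡-Reasoning
    at-edge : ∀ k → uncurry (pairVec (pairOf n k)) (pairOf n k₀) ≡ basis k (edgeOf k₀)
    at-edge k = refl

  -- The edge vectors span all of ℚ^E.
  basis-spans : ∀ U → IsMaxCut w U → InSpan w basis (queryVec w U)
  basis-spans U _ = (λ k → uncurry (cutVec U) (pairOf n k)) , λ e → sym (begin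
    sumℚ (λ k → uncurry (cutVec U) (pairOf n k) Q.* basis k e)
      ≡⟨ sumℚ-cong (λ k → cong (uncurry (cutVec U) (pairOf n k) Q.*_) (at e k)) ⟩
    sumℚ (λ k → uncurry (cutVec U) (pairOf n k) Q.* pairVec (pairOf n k) (proj₁ (proj₁ e)) (proj₂ (proj₁ e)))
      ≡⟨ sum-pairVec (cutVec U) (proj₁ (proj₂ e)) ⟩
    cutVec U (proj₁ (proj₁ e)) (proj₂ (proj₁ e)) ∎)
    where
    open ≡-Reasoning
    at : ∀ e k → basis k e ≡ pairVec (pairOf n k) (proj₁ (proj₁ e)) (proj₂ (proj₁ e))
    at e k = refl

-- Even n: lifting the odd basis and the degree argument

module _ where
  open Q using (_+_; _*_; _-_; -_)
  open ℚSolver.+-*-Solver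

  weight : ∀ {n} → List (ℚ × Subset n) → ℚ
  weight []            = 0ℚ
  weight ((c , _) ∷ L) = c + weight L

  degree-cutVec : ∀ {h n} → n ≡ h ℕ.+ h → (T : Subset n) → ∣ T ∣ ≡ h → ∀ v → sumℚ (λ u → cutVec T u v) ≡ h · 1ℚ
  degree-cutVec {h} n≡2h T ∣T∣≡h v =
    trans (sumℚ-cong (λ u → cong 𝟙 (BoolP.xor-comm (lookup T u) (lookup T v))))
          (trans (sum-𝟙-xor (lookup T v) T) (cong (_· 1ℚ) (either-side (lookup T v))))
    where
    either-side : ∀ s → (if s then ∣ ∁ T ∣ else ∣ T ∣) ≡ h
    either-side true  = ∣∁S∣-of-∣S∣ T n≡2h ∣T∣≡h
    either-side false = ∣T∣≡h

  degree-combination : ∀ {h n} → n ≡ h ℕ.+ h → (L : List (ℚ × Subset n)) → All ((_≡ h) ∘ ∣_∣ ∘ proj₂) L →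
    ∀ v → sumℚ (λ u → combination L u v) ≡ h · 1ℚ * weight L
  degree-combination {h} {n} n≡2h []            []                v =
    trans (sumℚ-zero n) (sym (ℚP.*-zeroʳ (h · 1ℚ)))
  degree-combination {h} n≡2h ((c , T) ∷ L) (∣T∣≡h ∷ L-bal) v = begin
    sumℚ (λ u → c * cutVec T u v + combination L u v)
      ≡⟨ sumℚ-+ (λ u → c * cutVec T u v) (λ u → combination L u v) ⟩
    sumℚ (λ u → c * cutVec T u v) + sumℚ (λ u → combination L u v)
      ≡⟨ cong₂ _+_ (sumℚ-*ˡ c (λ u → cutVec T u v)) (degree-combination n≡2h L L-bal v) ⟩
    c * sumℚ (λ u → cutVec T u v) + x * weight L
      ≡⟨ cong (λ y → c * y + x * weight L) (degree-cutVec n≡2h T ∣T∣≡h v) ⟩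
    c * x + x * weight L
      ≡⟨ solve 3 (λ c x s → c :* x :+ x :* s := x :* (c :+ s)) refl c x (weight L) ⟩
    x * weight ((c , T) ∷ L) ∎
    where
    open ≡-Reasoning
    x = h · 1ℚ

  -- All vertex degrees of Y = combination L equal D; vanishing inside {1, …, N} makes
  -- Y(0, l+1) = D for every l, so the degree at 0 is N · D = D.
  balanced-rigid : ∀ {h N} → suc N ≡ h ℕ.+ h → 1 ℕ.< N →
    (L : List (ℚ × Subset (suc N))) → All ((_≡ h) ∘ ∣_∣ ∘ proj₂) L →
    (λ a b → combination L (F.suc a) (F.suc b)) ≐ (λ _ _ → 0ℚ) → combination L ≐ (λ _ _ → 0ℚ)
  balanced-rigid {h} {N} n≡2h 1<N L L-bal inner≐0 = vanish
    where
    open ≡-Reasoning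

    D : ℚ
    D = h · 1ℚ * weight L

    inner : ∀ a b → combination L (F.suc a) (F.suc b) ≡ 0ℚ
    inner a b with FinP.<-cmp a b
    ... | tri< a<b _ _  = inner≐0 a b a<b
    ... | tri≈ _ refl _ = combination-diag L (F.suc a)
    ... | tri> _ _ b<a  = trans (combination-sym L (F.suc a) (F.suc b)) (inner≐0 b a b<a)

    spoke : ∀ l → combination L F.zero (F.suc l) ≡ D
    spoke l = begin
      combination L F.zero (F.suc l)
        ≡⟨ ℚP.+-identityʳ _ ⟨
      combination L F.zero (F.suc l) + 0ℚ
        ≡⟨ cong (combination L F.zero (F.suc l) +_) (trans (sumℚ-cong (λ a → inner a l)) (sumℚ-zero N)) ⟨
      combination L F.zero (F.suc l) + sumℚ (λ a → combination L (F.suc a) (F.suc l))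
        ≡⟨ degree-combination n≡2h L L-bal (F.suc l) ⟩
      D ∎

    D≡0 : D ≡ 0ℚ
    D≡0 = ·-fixed⇒0 N 1<N D (begin
      N · D
        ≡⟨ sumℚ-const N D ⟨
      sumℚ {N} (λ _ → D)
        ≡⟨ sumℚ-cong spoke ⟨
      sumℚ (λ l → combination L F.zero (F.suc l))
        ≡⟨ sumℚ-cong (λ l → combination-sym L F.zero (F.suc l)) ⟩
      sumℚ (λ l → combination L (F.suc l) F.zero)
        ≡⟨ ℚP.+-identityˡ _ ⟨
      0ℚ + sumℚ (λ l → combination L (F.suc l) F.zero)
        ≡⟨ cong (_+ sumℚ (λ l → combination L (F.suc l) F.zero)) (combination-diag L F.zero) ⟨
      combination L F.zero F.zero + sumℚ (λ l → combination L (F.suc l) F.zero)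
        ≡⟨ degree-combination n≡2h L L-bal F.zero ⟩
      D ∎)

    vanish : combination L ≐ (λ _ _ → 0ℚ)
    vanish F.zero    (F.suc l) _         = trans (spoke l) D≡0
    vanish (F.suc a) (F.suc b) (s≤s a<b) = inner≐0 a b a<b

lift : ∀ {N} → ℕ → Subset N → Subset (suc N)
lift m T = does (∣ T ∣ ℕ.≟ m) ∷ T

∣lift∣ : ∀ {N m} (T : Subset N) → NearHalf m T → ∣ lift m T ∣ ≡ suc m
∣lift∣ {m = m} T (inj₁ ∣T∣≡m)   rewrite dec-true (∣ T ∣ ℕ.≟ m) ∣T∣≡m = cong suc ∣T∣≡m
∣lift∣ {m = m} T (inj₂ ∣T∣≡1+m) rewrite dec-false (∣ T ∣ ℕ.≟ m) (λ ∣T∣≡m → ℕP.<-irrefl (trans (sym ∣T∣≡m) ∣T∣≡1+m) (ℕP.n<1+n m))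
  = ∣T∣≡1+m

liftList : ∀ {N} → ℕ → List (ℚ × Subset N) → List (ℚ × Subset (suc N))
liftList m []            = []
liftList m ((c , T) ∷ L) = (c , lift m T) ∷ liftList m L

liftList-balanced : ∀ {N m} (L : List (ℚ × Subset N)) → All (NearHalf m ∘ proj₂) L →
  All ((_≡ suc m) ∘ ∣_∣ ∘ proj₂) (liftList m L)
liftList-balanced []            []             = []
liftList-balanced ((c , T) ∷ L) (T-near ∷ L-near) = ∣lift∣ T T-near ∷ liftList-balanced L L-near

combination-liftList : ∀ {N} m (L : List (ℚ × Subset N)) a b →
  combination (liftList m L) (F.suc a) (F.suc b) ≡ combination L a b
combination-liftList m []            a b = refl
combination-liftList m ((c , T) ∷ L) a b = cong₂ (λ x y → c Q.* x Q.+ y) lifted-cut (combination-liftList m L a b)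
  where
  lifted-cut : cutVec (lift m T) (F.suc a) (F.suc b) ≡ cutVec T a b
  lifted-cut = refl

maxCutDim-even : ∀ m N → N ≡ suc (suc m ℕ.+ suc m) → MaxCutDim (completeGraph (suc N)) (pairCount N)
maxCutDim-even m N N≡2m+3 = basis , basis-in-space , basis-independent , basis-spans
  where
  open Q using (_+_; _*_; _-_; -_)
  open ℚSolver.+-*-Solver
  open ≡-Reasoning

  n = suc N
  h = suc (suc m)
  w = completeGraph n

  n≡2h : n ≡ h ℕ.+ h
  n≡2h = cong suc (trans N≡2m+3 (cong suc (sym (ℕP.+-suc m (suc m)))))

  room : 3 ℕ.+ m ≤ N
  room = subst (3 ℕ.+ m ≤_) (sym N≡2m+3) (s≤s (s≤s (ℕP.m≤n+m (suc m) m)))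

  spanned : ∀ k → Spanned (NearHalf (suc m)) (pairVec (pairOf N k))
  spanned k = pairVec-spanned m room (FinP.<⇒≢ (pairOf-< N k))

  lifted : Fin (pairCount N) → List (ℚ × Subset n)
  lifted k = liftList (suc m) (proj₁ (spanned k))

  lifted-balanced : ∀ k → All ((_≡ h) ∘ ∣_∣ ∘ proj₂) (lifted k)
  lifted-balanced k = liftList-balanced (proj₁ (spanned k)) (proj₁ (proj₂ (spanned k)))

  lifted-inner : ∀ k {a b} → a F.< b → combination (lifted k) (F.suc a) (F.suc b) ≡ pairVec (pairOf N k) a b
  lifted-inner k a<b = trans (combination-liftList (suc m) (proj₁ (spanned k)) _ _) (sym (proj₂ (proj₂ (spanned k)) _ _ a<b))

  basis : Fin (pairCount N) → EVec w
  basis k = toEdgeVec w (combination (lifted k))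

  basis-in-space : ∀ k → InMaxCutSpace w (basis k)
  basis-in-space k = Spanned⇒InMaxCutSpace (λ {S} → isMaxCut-even n≡2h S) (lifted k , lifted-balanced k , λ _ _ _ → refl)

  basis-independent : LinIndep w basis
  basis-independent c ∑≡0 k₀ = begin
    c k₀
      ≡⟨ sum-pairVec-pairOf N c k₀ ⟨
    sumℚ (λ k → c k * uncurry (pairVec (pairOf N k)) (pairOf N k₀))
      ≡⟨ sumℚ-cong (λ k → cong (c k *_) (sym (lifted-inner k (pairOf-< N k₀)))) ⟩
    sumℚ (λ k → c k * combination (lifted k) (F.suc (proj₁ (pairOf N k₀))) (F.suc (proj₂ (pairOf N k₀))))
      ≡⟨ sumℚ-cong (λ k → cong (c k *_) (at-edge k)) ⟩
    sumℚ (λ k → c k * basis k edge)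
      ≡⟨ ∑≡0 edge ⟩
    0ℚ ∎
    where
    edge : Edge w
    edge = shiftPair (pairOf N k₀) , s≤s (pairOf-< N k₀) , s≤s z≤n
    at-edge : ∀ k → combination (lifted k) (F.suc (proj₁ (pairOf N k₀))) (F.suc (proj₂ (pairOf N k₀))) ≡ basis k edge
    at-edge k = refl

  basis-spans : ∀ U → IsMaxCut w U → InSpan w basis (queryVec w U)
  basis-spans U U-max = coeff , λ e → spans-at (proj₁ (proj₁ e)) (proj₂ (proj₁ e)) (proj₁ (proj₂ e)) e refl
    where
    outer : Fin N → Fin N → ℚ
    outer x y = cutVec U (F.suc x) (F.suc y)

    coeff : Fin (pairCount N) → ℚ
    coeff k = uncurry outer (pairOf N k)

    stacked : List (ℚ × Subset n)
    stacked = List.concat (List.tabulate (λ k → scale (coeff k) (lifted k)))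

    residual : List (ℚ × Subset n)
    residual = (1ℚ , U) ∷ scale (- 1ℚ) stacked

    residual-balanced : All ((_≡ h) ∘ ∣_∣ ∘ proj₂) residual
    residual-balanced = maxCut-even-size n≡2h U U-max ∷
      AllP.map⁺ (AllP.concat⁺ (AllP.tabulate⁺ (λ k → AllP.map⁺ (lifted-balanced k))))

    residual-value : ∀ a b → combination residual a b ≡ cutVec U a b - sumℚ (λ k → coeff k * combination (lifted k) a b)
    residual-value a b = begin
      1ℚ * cutVec U a b + combination (scale (- 1ℚ) stacked) a b
        ≡⟨ cong (1ℚ * cutVec U a b +_) (combination-scale a b (- 1ℚ) stacked) ⟩
      1ℚ * cutVec U a b + - 1ℚ * combination stacked a b
        ≡⟨ cong (λ s → 1ℚ * cutVec U a b + - 1ℚ * s)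
                (trans (combination-concat a b (λ k → scale (coeff k) (lifted k)))
                       (sumℚ-cong (λ k → combination-scale a b (coeff k) (lifted k)))) ⟩
      1ℚ * cutVec U a b + - 1ℚ * sumℚ (λ k → coeff k * combination (lifted k) a b)
        ≡⟨ solve 2 (λ u s → con 1ℚ :* u :+ (:- con 1ℚ) :* s := u :- s) refl
                 (cutVec U a b) (sumℚ (λ k → coeff k * combination (lifted k) a b)) ⟩
      cutVec U a b - sumℚ (λ k → coeff k * combination (lifted k) a b) ∎

    residual-inner : (λ a b → combination residual (F.suc a) (F.suc b)) ≐ (λ _ _ → 0ℚ)
    residual-inner a b a<b = begin
      combination residual (F.suc a) (F.suc b)
        ≡⟨ residual-value (F.suc a) (F.suc b) ⟩
      outer a b - sumℚ (λ k → coeff k * combination (lifted k) (F.suc a) (F.suc b))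
        ≡⟨ cong (λ s → outer a b - s) (sumℚ-cong (λ k → cong (coeff k *_) (lifted-inner k a<b))) ⟩
      outer a b - sumℚ (λ k → coeff k * pairVec (pairOf N k) a b)
        ≡⟨ cong (λ s → outer a b - s) (sum-pairVec outer a<b) ⟩
      outer a b - outer a b
        ≡⟨ ℚP.+-inverseʳ (outer a b) ⟩
      0ℚ ∎

    spans-at : ∀ a b → a F.< b → (e : Edge w) → proj₁ e ≡ (a , b) →
      queryVec w U e ≡ sumℚ (λ k → coeff k * basis k e)
    spans-at a b a<b e refl = begin
      cutVec U a b
        ≡⟨ x∙y⁻¹≈ε⇒x≈y _ _ (trans (sym (residual-value a b))
             (balanced-rigid n≡2h (subst (1 ℕ.<_) (sym N≡2m+3) (s≤s (s≤s z≤n))) residual residual-balanced residual-inner a b a<b)) ⟩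
      sumℚ (λ k → coeff k * combination (lifted k) a b)
        ≡⟨ sumℚ-cong (λ k → cong (coeff k *_) (at k)) ⟩
      sumℚ (λ k → coeff k * basis k e) ∎
      where
      at : ∀ k → combination (lifted k) a b ≡ basis k e
      at k = refl

module _ where
  open import Data.Nat using (_+_; _*_; _/_)
  open import Data.Nat.DivMod using (m≡m%n+[m/n]*n)

  private
    parity-split : ∀ n → n ≡ n % 2 + (n / 2 + n / 2)
    parity-split n = trans (m≡m%n+[m/n]*n n 2)
      (cong (n % 2 +_) (trans (ℕP.*-comm (n / 2) 2) (cong (n / 2 +_) (ℕP.+-identityʳ (n / 2)))))

  odd-form : ∀ n → 3 ≤ n → n % 2 ≡ 1 → ∃[ m ] n ≡ suc (suc m + suc m)
  odd-form n 3≤n n%2≡1 with n / 2 | trans (parity-split n) (cong (_+ (n / 2 + n / 2)) n%2≡1)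
  ... | zero  | n≡1   = contradiction (subst (3 ≤_) n≡1 3≤n) λ { (s≤s ()) }
  ... | suc m | n≡2m+3 = m , n≡2m+3

  even-form : ∀ n → 3 ≤ n → n % 2 ≡ 0 → ∃[ m ] n ≡ suc (suc (suc m + suc m))
  even-form n 3≤n n%2≡0 with n / 2 | trans (parity-split n) (cong (_+ (n / 2 + n / 2)) n%2≡0)
  ... | zero        | n≡0 = contradiction (subst (3 ≤_) n≡0 3≤n) λ ()
  ... | suc zero    | n≡2 = contradiction (subst (3 ≤_) n≡2 3≤n) λ { (s≤s (s≤s ())) }
  ... | suc (suc m) | n≡2m+4 = m , trans n≡2m+4 (cong suc (ℕP.+-suc (suc m) (suc m)))

lemmaA4 : (n : ℕ) → 3 ≤ n →
    (n % 2 ≡ 1 → MaxCutDim (completeGraph n) (n C 2)) ×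
    (n % 2 ≡ 0 → MaxCutDim (completeGraph n) ((n ∸ 1) C 2))
lemmaA4 n 3≤n = odd-case , even-case
  where
  odd-case : n % 2 ≡ 1 → MaxCutDim (completeGraph n) (n C 2)
  odd-case n%2≡1 with odd-form n 3≤n n%2≡1
  ... | m , n≡2m+3 = subst (MaxCutDim (completeGraph n)) (pairCount≡C2 n) (maxCutDim-odd m n n≡2m+3)

  even-case : n % 2 ≡ 0 → MaxCutDim (completeGraph n) ((n ∸ 1) C 2)
  even-case n%2≡0 with even-form n 3≤n n%2≡0
  ... | m , refl = subst (MaxCutDim (completeGraph n)) (pairCount≡C2 (n ∸ 1)) (maxCutDim-even m (n ∸ 1) refl)
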